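{- Let $H=T\cup C$ be a Halin graph, let $T$ be rooted at a vertex and let $d$ be the depth of $T$. For every integer $i\geq 1$ and every set $S$ of $i$ edges of $C$, the number of spanning trees $T'$ of $H$ with $E(T')\cap E(C)=S$ is at most $i!\cdot(2d)^i$.
   Context: A Halin graph $H=T\cup C$ is obtained from a tree $T$ (the characteristic tree) that has no vertex of degree two and at least three leaves, by adding a cycle $C$ (the accompanying cycle) through all leaves of $T$, in the cyclic order of a plane embedding of $T$. For a rooted tree $T$, its depth is the length (number of edges) of a longest path from the root to a leaf. The edges of $S$ need not be consecutive on $C$. -}

module Defs where

open import Data.Nat using (ℕ; zero; suc; _+_; _*_; _≤_; _≡ᵇ_)
open import Data.Fin using (Fin; _≟_)
open import Data.Bool using (Bool; true; false; if_then_else_)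
open import Data.List using (List; []; _∷_; length; _++_)
open import Data.List.Membership.Propositional using (_∈_)
open import Data.List.Relation.Unary.Unique.Propositional using (Unique)
open import Data.List.Relation.Unary.Linked using (Linked)
open import Data.Product using (Σ; ∃; _×_; _,_)
open import Data.Sum using (_⊎_)
open import Relation.Nullary using (¬_; does)
open import Relation.Binary.PropositionalEquality using (_≡_; _≢_)
open import Relation.Binary.Construct.Closure.ReflexiveTransitive using (Star)

lastOf : ∀ {n} → Fin n → List (Fin n) → Fin n
lastOf u []       = u
lastOf u (x ∷ xs) = lastOf x xs

Path : ∀ {n} → (Fin n → Fin n → Set) → Fin n → Fin n → ℕ → Set
Path {n} Adj u v k =
  Σ (List (Fin n)) λ xs →
    Unique (u ∷ xs) × Linked Adj (u ∷ xs) × length xs ≡ k × lastOf u xs ≡ v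

HasCycle : ∀ {n} → (Fin n → Fin n → Set) → Set
HasCycle {n} Adj =
  Σ (Fin n) λ x → Σ (List (Fin n)) λ xs →
    2 ≤ length xs × Unique (x ∷ xs) × Linked Adj (x ∷ xs ++ x ∷ [])

Connected : ∀ {n} → (Fin n → Fin n → Set) → Set
Connected {n} Adj = (u v : Fin n) → Star Adj u v

IsTree : ∀ {n} → (Fin n → Fin n → Set) → Set
IsTree Adj = Connected Adj × ¬ HasCycle Adj

-- Plane trees as combinatorial embeddings (rotation systems).
-- ρ v lists the neighbours of v in the cyclic (say clockwise) order
-- around v in the plane embedding.

Rotation : ℕ → Set
Rotation n = Fin n → List (Fin n)

AdjT : ∀ {n} → Rotation n → Fin n → Fin n → Set
AdjT ρ u v = v ∈ ρ u

IsPlaneTree : ∀ {n} → Rotation n → Set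
IsPlaneTree {n} ρ =
  ((v : Fin n) → Unique (ρ v)) ×
  ((v : Fin n) → ¬ (v ∈ ρ v)) ×
  ((u v : Fin n) → v ∈ ρ u → u ∈ ρ v) ×
  IsTree (AdjT ρ)

IsLeaf : ∀ {n} → Rotation n → Fin n → Set
IsLeaf ρ v = length (ρ v) ≡ 1

isLeafᵇ : ∀ {n} → Rotation n → Fin n → Bool
isLeafᵇ ρ v = length (ρ v) ≡ᵇ 1

cycSucc : ∀ {n} → List (Fin n) → Fin n → Fin n
cycSucc {n} [] u = u
cycSucc {n} (x ∷ xs) u = go (x ∷ xs)
  where
  go : List (Fin n) → Fin n
  go []           = u
  go (y ∷ [])     = if does (y ≟ u) then x else u
  go (y ∷ z ∷ r)  = if does (y ≟ u) then z else go (z ∷ r)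

-- face tracing: dart (u , v) ↦ (v , successor of u around v)
step : ∀ {n} → Rotation n → Fin n × Fin n → Fin n × Fin n
step ρ (u , v) = v , cycSucc (ρ v) u

findLeaf : ∀ {n} → Rotation n → ℕ → Fin n × Fin n → Fin n
findLeaf ρ zero    (u , v) = v
findLeaf ρ (suc k) (u , v) =
  if isLeafᵇ ρ v then v else findLeaf ρ k (step ρ (u , v))

-- the leaf following the leaf l in the cyclic order of leaves of the
-- plane tree (the boundary walk visits the 2(n-1) darts, so fuel 2n suffices)
nextLeaf : ∀ {n} → Rotation n → Fin n → Fin n
nextLeaf ρ l with ρ l
... | []      = l
nextLeaf {n} ρ l | p ∷ _ = findLeaf ρ (2 * n) (l , p)

IsHalinTree : ∀ {n} → Rotation n → Set
IsHalinTree {n} ρ =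
  IsPlaneTree ρ ×
  ((v : Fin n) → length (ρ v) ≢ 2) ×
  (Σ (Fin n) λ a → Σ (Fin n) λ b → Σ (Fin n) λ c →
     IsLeaf ρ a × IsLeaf ρ b × IsLeaf ρ c × a ≢ b × a ≢ c × b ≢ c)

AdjC : ∀ {n} → Rotation n → Fin n → Fin n → Set
AdjC ρ u v = (IsLeaf ρ u × nextLeaf ρ u ≡ v) ⊎ (IsLeaf ρ v × nextLeaf ρ v ≡ u)

AdjH : ∀ {n} → Rotation n → Fin n → Fin n → Set
AdjH ρ u v = AdjT ρ u v ⊎ AdjC ρ u v

IsDepth : ∀ {n} → Rotation n → Fin n → ℕ → Set
IsDepth {n} ρ r d =
  ((l : Fin n) (k : ℕ) → IsLeaf ρ l → Path (AdjT ρ) r l k → k ≤ d) ×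
  (Σ (Fin n) λ l → IsLeaf ρ l × Path (AdjT ρ) r l d)

-- edge sets of spanning subgraphs, as symmetric Boolean relations

EdgeSet : ℕ → Set
EdgeSet n = Fin n → Fin n → Bool

Differ : ∀ {n} → EdgeSet n → EdgeSet n → Set
Differ {n} F G = Σ (Fin n) λ u → Σ (Fin n) λ v → F u v ≢ G u v

IsSpanningTreeOfH : ∀ {n} → Rotation n → EdgeSet n → Set
IsSpanningTreeOfH {n} ρ F =
  ((u v : Fin n) → F u v ≡ F v u) ×
  ((u v : Fin n) → F u v ≡ true → AdjH ρ u v) ×
  IsTree (λ u v → F u v ≡ true)

-- Root T at r. Off T, a spanning tree F of H with E(F) ∩ E(C) = S consists of the k edges of S
-- that are not in T; since F and T have equally many edges, F omits exactly k ≤ i edges of T, and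
-- F is determined by which. Each omitted edge {a , parent a} has a on the root path of an end of
-- an edge of S, for otherwise the path in F from r to a could never enter the subtree below that
-- edge. So the omitted edges form a k-subset of at most 2di vertices, and C(2di, k) ≤ i! (2d)^i.

module Submission where

open import Defs

open import Data.Bool using (Bool; true; false; _∧_; _∨_; not; if_then_else_)
import Data.Bool.Properties as Bool
open import Data.Empty using (⊥)
open import Data.Fin using (Fin; zero; suc; _≟_)
open import Data.Fin.Properties using (any?)
open import Data.Fin.Subset using (Subset; ∣_∣) renaming (_∈_ to _∈ₛ_)
import Data.Fin.Subset.Properties as Subset
open import Data.List using (List; []; _∷_; length; _++_; map; allFin)
open import Data.List.Extrema.Nat using (argmax; f[xs]≤f[argmax])
open import Data.List.Membership.Propositional using (_∈_)
open import Data.List.Membership.Propositional.Properties using (∈-allFin)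
open import Data.List.Properties using (length-++; length-map)
open import Data.List.Relation.Unary.All using (All; []; _∷_)
import Data.List.Relation.Unary.All as All
import Data.List.Relation.Unary.All.Properties as All
open import Data.List.Relation.Unary.AllPairs using (AllPairs; []; _∷_)
import Data.List.Relation.Unary.AllPairs as AllPairs
import Data.List.Relation.Unary.AllPairs.Properties as AllPairs
open import Data.List.Relation.Unary.Any using (here; there)
open import Data.List.Relation.Unary.Linked using (Linked; []; [-]; _∷_)
import Data.List.Relation.Unary.Linked as Linked
import Data.List.Relation.Unary.Linked.Properties as Linked
open import Data.List.Relation.Unary.Unique.Propositional using (Unique)
open import Data.Nat hiding (_≟_)
open import Data.Nat.Combinatorics using (_C_; nCk≡nPk/k!; nCk+nC[k+1]≡[n+1]C[k+1])
open import Data.Nat.Combinatorics.Base using (_P′_)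
open import Data.Nat.Combinatorics.Specification using (nPk≡n!/[n∸k]!; nP′k≡n!/[n∸k]!; k!∣nP′k; k>n⇒nCk≡0)
open import Data.Nat.DivMod using (_/_; m*[n/m]≡n; m/n≤m; m*n/n≡m; /-monoˡ-≤)
open import Data.Nat.Properties hiding (_≟_)
open import Data.Nat.Tactic.RingSolver using (solve-∀)
open import Data.Product using (∃-syntax; _×_; _,_; proj₁; proj₂)
open import Data.Sum using (_⊎_; inj₁; inj₂)
open import Data.Vec using ([]; _∷_)
open import Function using (_∘_; case_of_)
open import Function.Bundles using (mk⇔; _⇔_; Equivalence)
open import Relation.Binary using (tri<; tri≈; tri>)
open import Relation.Binary.Construct.Closure.ReflexiveTransitive using (Star; ε; _◅_; _◅◅_)
import Relation.Binary.Construct.Closure.ReflexiveTransitive as Star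
open import Relation.Binary.PropositionalEquality
open import Relation.Nullary using (does; yes; no; ¬_; contradiction)
open import Relation.Nullary.Decidable using (Dec; _⊎-dec_; _×-dec_; dec-true; dec-false; does-⇔)
open import Relation.Unary using (Decidable)

open import Algebra.Properties.CommutativeSemigroup *-commutativeSemigroup using (x∙yz≈z∙yx)
open import Algebra.Properties.Semiring.Sum +-*-semiring
  using (sum; sum-syntax; sum-cong-≗; ∑-distrib-+; ∑-comm; sum-replicate-zero; *-distribʳ-sum)

-- Binomial estimates

^-distribʳ-* : ∀ m n k → (m * n) ^ k ≡ m ^ k * n ^ k
^-distribʳ-* m n zero    = refl
^-distribʳ-* m n (suc k) = begin
  m * n * (m * n) ^ k       ≡⟨ cong (m * n *_) (^-distribʳ-* m n k) ⟩
  m * n * (m ^ k * n ^ k)   ≡⟨ [m*n]*[o*p]≡[m*o]*[n*p] m n (m ^ k) (n ^ k) ⟩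
  m * m ^ k * (n * n ^ k)   ∎
  where open ≡-Reasoning

nP′k≤n^k : ∀ n k → n P′ k ≤ n ^ k
nP′k≤n^k n zero    = ≤-refl
nP′k≤n^k n (suc k) = *-mono-≤ (m∸n≤m n k) (nP′k≤n^k n k)

nP′k≤n! : ∀ {n k} → k ≤ n → n P′ k ≤ n !
nP′k≤n! {n} {k} k≤n = subst (_≤ n !) (sym (nP′k≡n!/[n∸k]! k≤n)) (m/n≤m (n !) ((n ∸ k) !) {{(n ∸ k) !≢0}})

k!*nCk≤n^k : ∀ n k → k ! * (n C k) ≤ n ^ k
k!*nCk≤n^k n k with k ≤? n
... | no k≰n = begin
  k ! * (n C k)  ≡⟨ cong (k ! *_) (k>n⇒nCk≡0 (≰⇒> k≰n)) ⟩
  k ! * 0        ≡⟨ *-zeroʳ (k !) ⟩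
  0              ≤⟨ z≤n ⟩
  n ^ k          ∎
  where open ≤-Reasoning
... | yes k≤n = begin
  k ! * (n C k)            ≡⟨ cong (k ! *_) nCk≡nP′k/k! ⟩
  k ! * ((n P′ k) / k !)   ≡⟨ m*[n/m]≡n (k!∣nP′k k≤n) ⟩
  n P′ k                   ≤⟨ nP′k≤n^k n k ⟩
  n ^ k                    ∎
  where
  open ≤-Reasoning
  instance _ = k !≢0
  nCk≡nP′k/k! : n C k ≡ (n P′ k) / k !
  nCk≡nP′k/k! = trans (nCk≡nPk/k! k≤n) (cong (_/ k !) (trans (nPk≡n!/[n∸k]! k≤n) (sym (nP′k≡n!/[n∸k]! k≤n))))

n≤[1+k]*[n∸k] : ∀ {n k} → k < n → n ≤ suc k * (n ∸ k)
n≤[1+k]*[n∸k] {n} {k} k<n = begin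
  n                      ≡⟨ m+[n∸m]≡n k<n ⟨
  suc k + t              ≤⟨ +-monoʳ-≤ (suc k) (m≤n*m t (suc k)) ⟩
  suc k + suc k * t      ≡⟨ *-suc (suc k) t ⟨
  suc k * suc t          ≡⟨ cong (suc k *_) (+-∸-assoc 1 k<n) ⟨
  suc k * (n ∸ k)        ∎
  where
  open ≤-Reasoning
  t = n ∸ suc k

n^k≤nP′k*k! : ∀ {n k} → k ≤ n → n ^ k ≤ (n P′ k) * k !
n^k≤nP′k*k! {n} {zero}  _   = ≤-refl
n^k≤nP′k*k! {n} {suc k} k<n = begin
  n * n ^ k                                ≤⟨ *-mono-≤ (n≤[1+k]*[n∸k] k<n) (n^k≤nP′k*k! (<⇒≤ k<n)) ⟩
  suc k * (n ∸ k) * ((n P′ k) * k !)       ≡⟨ rearrange (suc k) (n ∸ k) (n P′ k) (k !) ⟩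
  (n ∸ k) * (n P′ k) * (suc k * k !)       ∎
  where
  open ≤-Reasoning
  rearrange : ∀ a b c d → a * b * (c * d) ≡ b * c * (a * d)
  rearrange = solve-∀

C-bound : ∀ {a i m k} → 1 ≤ a → k ≤ i → m ≤ a * i → m C k ≤ i ! * a ^ i
C-bound {a} {i} {m} {k} 1≤a k≤i m≤ai = *-cancelˡ-≤ (k !) {{k !≢0}} (begin
  k ! * (m C k)              ≤⟨ k!*nCk≤n^k m k ⟩
  m ^ k                      ≤⟨ ^-monoˡ-≤ k m≤ai ⟩
  (a * i) ^ k                ≡⟨ ^-distribʳ-* a i k ⟩
  a ^ k * i ^ k              ≤⟨ *-mono-≤ (^-monoʳ-≤ a {{>-nonZero 1≤a}} k≤i) (n^k≤nP′k*k! k≤i) ⟩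
  a ^ i * ((i P′ k) * k !)   ≤⟨ *-monoʳ-≤ (a ^ i) (*-monoˡ-≤ (k !) (nP′k≤n! k≤i)) ⟩
  a ^ i * (i ! * k !)        ≡⟨ x∙yz≈z∙yx (a ^ i) (i !) (k !) ⟩
  k ! * (i ! * a ^ i)        ∎)
  where open ≤-Reasoning

-- Indicator sums over Fin n

𝟙 : Bool → ℕ
𝟙 b = if b then 1 else 0

∧-true : ∀ {a b} → a ∧ b ≡ true → a ≡ true × b ≡ true
∧-true {true} {true} _ = refl , refl

does-true : ∀ {A : Set} (a? : Dec A) → does a? ≡ true → A
does-true (yes a) _ = a

does-false : ∀ {A : Set} (a? : Dec A) → not (does a?) ≡ true → ¬ A
does-false (no ¬a) _ = ¬a

≡-does : ∀ {A : Set} {b} (a? : Dec A) → b ≡ true ⇔ A → b ≡ does a?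
≡-does     (yes a)  b⇔A = Equivalence.from b⇔A a
≡-does {b = false} (no _)  _   = refl
≡-does {b = true}  (no ¬a) b⇔A = contradiction (Equivalence.to b⇔A refl) ¬a

∑-mono-≤ : ∀ {n} {f g : Fin n → ℕ} → (∀ i → f i ≤ g i) → sum f ≤ sum g
∑-mono-≤ {zero}  f≤g = z≤n
∑-mono-≤ {suc n} f≤g = +-mono-≤ (f≤g zero) (∑-mono-≤ (f≤g ∘ suc))

∑-𝟙-point : ∀ {n} (w : Fin n) (f : Fin n → Bool) →
            ∑[ v < n ] 𝟙 (does (w ≟ v) ∧ f v) ≡ 𝟙 (f w)
∑-𝟙-point {suc n} zero    f = trans (cong (𝟙 (f zero) +_) (sum-replicate-zero n)) (+-identityʳ _)
∑-𝟙-point {suc n} (suc w) f = ∑-𝟙-point w (f ∘ suc)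

∣_∣ᵇ : ∀ {n} → (Fin n → Bool) → ℕ
∣_∣ᵇ {n} X = ∑[ i < n ] 𝟙 (X i)

pairCount : ∀ {n} → (Fin n → Fin n → Bool) → ℕ
pairCount {n} R = ∑[ u < n ] ∑[ v < n ] 𝟙 (not (does (u ≟ v)) ∧ R u v)

∣p∣≡∣∈?∣ᵇ : ∀ {n} (p : Subset n) → ∣ p ∣ ≡ ∣ (λ x → does (x Subset.∈? p)) ∣ᵇ
∣p∣≡∣∈?∣ᵇ []          = refl
∣p∣≡∣∈?∣ᵇ (true ∷ p)  = cong suc (∣p∣≡∣∈?∣ᵇ p)
∣p∣≡∣∈?∣ᵇ (false ∷ p) = ∣p∣≡∣∈?∣ᵇ p

𝟙-∨ : ∀ a b → 𝟙 (a ∨ b) ≤ 𝟙 a + 𝟙 b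
𝟙-∨ true  _ = s≤s z≤n
𝟙-∨ false _ = ≤-refl

𝟙-∧≤ʳ : ∀ a b → 𝟙 (a ∧ b) ≤ 𝟙 b
𝟙-∧≤ʳ true  _ = ≤-refl
𝟙-∧≤ʳ false _ = z≤n

𝟙-split : ∀ a b → 𝟙 a ≡ 𝟙 (a ∧ b) + 𝟙 (a ∧ not b)
𝟙-split false _     = refl
𝟙-split true  true  = refl
𝟙-split true  false = refl

𝟙-any≤∑ : ∀ {m} {P : Fin m → Set} (P? : Decidable P) → 𝟙 (does (any? P?)) ≤ ∑[ l < m ] 𝟙 (does (P? l))
𝟙-any≤∑ {zero}  P? = z≤n
𝟙-any≤∑ {suc m} P? =
  ≤-trans (𝟙-∨ (does (P? zero)) _) (+-monoʳ-≤ (𝟙 (does (P? zero))) (𝟙-any≤∑ (P? ∘ suc)))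

module _ {n : ℕ} where

  open import Data.List.Membership.DecPropositional (_≟_ {n}) using (_∈?_)

  ∣∈?∣ᵇ≤length : ∀ (xs : List (Fin n)) → ∣ (λ a → does (a ∈? xs)) ∣ᵇ ≤ length xs
  ∣∈?∣ᵇ≤length []       = ≤-reflexive (sum-replicate-zero n)
  ∣∈?∣ᵇ≤length (x ∷ xs) = begin
    ∑[ a < n ] 𝟙 (does (a ≟ x) ∨ does (a ∈? xs))             ≤⟨ ∑-mono-≤ (λ a → 𝟙-∨ (does (a ≟ x)) _) ⟩
    ∑[ a < n ] (𝟙 (does (a ≟ x)) + 𝟙 (does (a ∈? xs)))       ≡⟨ ∑-distrib-+ (λ a → 𝟙 (does (a ≟ x))) _ ⟩
    ∑[ a < n ] 𝟙 (does (a ≟ x)) + ∣ (λ a → does (a ∈? xs)) ∣ᵇ ≡⟨ cong (_+ _) one ⟩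
    suc ∣ (λ a → does (a ∈? xs)) ∣ᵇ                          ≤⟨ s≤s (∣∈?∣ᵇ≤length xs) ⟩
    suc (length xs)                                          ∎
    where
    open ≤-Reasoning
    one : ∑[ a < n ] 𝟙 (does (a ≟ x)) ≡ 1
    one = trans (sum-cong-≗ λ a → cong 𝟙 (trans (does-⇔ (mk⇔ sym sym) (a ≟ x) (x ≟ a)) (sym (Bool.∧-identityʳ _))))
                (∑-𝟙-point x (λ _ → true))

∑∑-symmetrize : ∀ {n} (f : Fin n → Fin n → ℕ) →
                ∑[ u < n ] ∑[ v < n ] (f u v + f v u) ≡ 2 * ∑[ u < n ] ∑[ v < n ] f u v
∑∑-symmetrize {n} f = begin
  ∑[ u < n ] ∑[ v < n ] (f u v + f v u)             ≡⟨ sum-cong-≗ (λ u → ∑-distrib-+ (f u) (λ v → f v u)) ⟩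
  ∑[ u < n ] (∑[ v < n ] f u v + ∑[ v < n ] f v u)  ≡⟨ ∑-distrib-+ (λ u → sum (f u)) (λ u → ∑[ v < n ] f v u) ⟩
  N + ∑[ u < n ] ∑[ v < n ] f v u                   ≡⟨ cong (N +_) (∑-comm (λ u v → f v u)) ⟩
  N + N                                             ≡⟨ cong (N +_) (+-identityʳ N) ⟨
  2 * N                                             ∎
  where
  open ≡-Reasoning
  N = ∑[ u < n ] ∑[ v < n ] f u v

pairCount-cong : ∀ {n} {R R′ : Fin n → Fin n → Bool} → (∀ u v → R u v ≡ R′ u v) → pairCount R ≡ pairCount R′
pairCount-cong R≡R′ = sum-cong-≗ λ u → sum-cong-≗ λ v → cong (λ b → 𝟙 (not (does (u ≟ v)) ∧ b)) (R≡R′ u v)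

pairCount-split : ∀ {n} (R T : Fin n → Fin n → Bool) →
                  pairCount R ≡ pairCount (λ u v → R u v ∧ T u v) + pairCount (λ u v → R u v ∧ not (T u v))
pairCount-split {n} R T =
  trans (sum-cong-≗ λ u → trans (sum-cong-≗ (split u)) (∑-distrib-+ (with-T u) (without-T u)))
        (∑-distrib-+ (λ u → sum (with-T u)) (λ u → sum (without-T u)))
  where
  with-T without-T : Fin n → Fin n → ℕ
  with-T    u v = 𝟙 (not (does (u ≟ v)) ∧ (R u v ∧ T u v))
  without-T u v = 𝟙 (not (does (u ≟ v)) ∧ (R u v ∧ not (T u v)))
  split : ∀ u v → 𝟙 (not (does (u ≟ v)) ∧ R u v) ≡ with-T u v + without-T u v
  split u v rewrite sym (Bool.∧-assoc (not (does (u ≟ v))) (R u v) (T u v))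
                  | sym (Bool.∧-assoc (not (does (u ≟ v))) (R u v) (not (T u v))) = 𝟙-split _ (T u v)

-- Families of distinct subsets

_⊆ᵇ_ : ∀ {n} → (Fin n → Bool) → (Fin n → Bool) → Set
X ⊆ᵇ Y = ∀ i → X i ≡ true → Y i ≡ true

Differs : ∀ {n} → (Fin n → Bool) → (Fin n → Bool) → Set
Differs X Y = ∃[ i ] X i ≢ Y i

module _ {n : ℕ} where

  restrict : Bool → List (Fin (suc n) → Bool) → List (Fin n → Bool)
  restrict b []      = []
  restrict b (X ∷ L) with X zero Bool.≟ b
  ... | yes _ = X ∘ suc ∷ restrict b L
  ... | no  _ = restrict b L

  length-restrict : ∀ L → length (restrict true L) + length (restrict false L) ≡ length L
  length-restrict []      = refl
  length-restrict (X ∷ L) with X zero Bool.≟ true | X zero Bool.≟ false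
  ... | yes _   | no _    = cong suc (length-restrict L)
  ... | no _    | yes _   = trans (+-suc _ _) (cong suc (length-restrict L))
  ... | yes X₀≡t | yes X₀≡f = contradiction (trans (sym X₀≡t) X₀≡f) λ ()
  ... | no X₀≢t | no X₀≢f  = contradiction (Bool.¬-not X₀≢t) X₀≢f

  All-restrict : ∀ {P : (Fin (suc n) → Bool) → Set} {Q : (Fin n → Bool) → Set} b →
                 (∀ {X} → X zero ≡ b → P X → Q (X ∘ suc)) →
                 ∀ {L} → All P L → All Q (restrict b L)
  All-restrict b P⇒Q {[]}    []         = []
  All-restrict b P⇒Q {X ∷ L} (PX ∷ PL) with X zero Bool.≟ b
  ... | yes X₀≡b = P⇒Q X₀≡b PX ∷ All-restrict b P⇒Q PL
  ... | no  _    = All-restrict b P⇒Q PL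

  AllPairs-restrict : ∀ b {L : List (Fin (suc n) → Bool)} → AllPairs Differs L → AllPairs Differs (restrict b L)
  AllPairs-restrict b {[]}    []          = []
  AllPairs-restrict b {X ∷ L} (X≠L ∷ ≠L) with X zero Bool.≟ b
  ... | yes X₀≡b = All-restrict b differs-tail X≠L ∷ AllPairs-restrict b ≠L
    where
    differs-tail : ∀ {Y} → Y zero ≡ b → Differs X Y → Differs (X ∘ suc) (Y ∘ suc)
    differs-tail Y₀≡b (zero  , X₀≢Y₀) = contradiction (trans X₀≡b (sym Y₀≡b)) X₀≢Y₀
    differs-tail Y₀≡b (suc i , Xi≢Yi) = i , Xi≢Yi
  ... | no  _    = AllPairs-restrict b ≠L

length-All⊥ : ∀ {A : Set} {xs : List A} → All (λ _ → ⊥) xs → length xs ≡ 0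
length-All⊥ [] = refl

-- Induction on the ground set, splitting the family by the value at the first point: Pascal's rule.
distinct-subsets≤C : ∀ {n k} (U : Fin n → Bool) (L : List (Fin n → Bool)) → AllPairs Differs L →
                     All (λ X → X ⊆ᵇ U × ∣ X ∣ᵇ ≡ k) L → length L ≤ ∣ U ∣ᵇ C k

restrict-subsets≤C : ∀ {n k} b (U : Fin (suc n) → Bool) (L : List (Fin (suc n) → Bool)) → AllPairs Differs L →
                     All (λ X → X ⊆ᵇ U × ∣ X ∣ᵇ ≡ 𝟙 b + k) L → length (restrict b L) ≤ ∣ U ∘ suc ∣ᵇ C k
restrict-subsets≤C {k = k} b U L ≠L XL =
  distinct-subsets≤C (U ∘ suc) (restrict b L) (AllPairs-restrict b ≠L) (All-restrict b tail XL)
  where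
  tail : ∀ {X} → X zero ≡ b → X ⊆ᵇ U × ∣ X ∣ᵇ ≡ 𝟙 b + k →
         (X ∘ suc) ⊆ᵇ (U ∘ suc) × ∣ X ∘ suc ∣ᵇ ≡ k
  tail X₀≡b (X⊆U , ∣X∣≡b+k) =
    X⊆U ∘ suc , +-cancelˡ-≡ (𝟙 b) _ _ (trans (cong (λ x → 𝟙 x + _) (sym X₀≡b)) ∣X∣≡b+k)

subsets-without-zero≤C : ∀ {n k} (U : Fin (suc n) → Bool) (L : List (Fin (suc n) → Bool)) →
                         AllPairs Differs L → All (λ X → X ⊆ᵇ U × ∣ X ∣ᵇ ≡ k) L →
                         (∀ {X} → X zero ≡ true → ¬ (X ⊆ᵇ U × ∣ X ∣ᵇ ≡ k)) →
                         length (restrict true L) + length (restrict false L) ≤ ∣ U ∘ suc ∣ᵇ C k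
subsets-without-zero≤C U L ≠L XL no-first =
  subst (_≤ _) (cong (_+ length (restrict false L)) (sym (length-All⊥ (All-restrict true no-first XL))))
        (restrict-subsets≤C false U L ≠L XL)

distinct-subsets≤C {zero} U []          _                     _                  = z≤n
distinct-subsets≤C {zero} U (_ ∷ [])    _                     ((_ , refl) ∷ [])  = ≤-refl
distinct-subsets≤C {zero} U (_ ∷ _ ∷ _) (((() , _) ∷ _) ∷ _)  _
distinct-subsets≤C {suc n} {k} U L ≠L XL rewrite sym (length-restrict L) with U zero in U₀ | k
... | false | k     = subsets-without-zero≤C U L ≠L XL λ X₀≡t (X⊆U , _) →
  case trans (sym (X⊆U zero X₀≡t)) U₀ of λ ()
... | true  | zero  = subsets-without-zero≤C U L ≠L XL λ {X} X₀≡t (_ , ∣X∣≡0) →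
  case trans (cong (λ x → 𝟙 x + ∣ X ∘ suc ∣ᵇ) (sym X₀≡t)) ∣X∣≡0 of λ ()
... | true  | suc k = begin
  length (restrict true L) + length (restrict false L)  ≤⟨ +-mono-≤ (restrict-subsets≤C true U L ≠L XL)
                                                                    (restrict-subsets≤C false U L ≠L XL) ⟩
  ∣ U ∘ suc ∣ᵇ C k + ∣ U ∘ suc ∣ᵇ C suc k               ≡⟨ nCk+nC[k+1]≡[n+1]C[k+1] _ k ⟩
  suc ∣ U ∘ suc ∣ᵇ C suc k                              ∎
  where open ≤-Reasoning

-- Lists, walks and cycles

lastOf-snoc : ∀ {n} (r x : Fin n) xs → lastOf r (xs ++ x ∷ []) ≡ x
lastOf-snoc r x []       = refl
lastOf-snoc r x (y ∷ ys) = lastOf-snoc y x ys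

length≡1 : ∀ {n} {w : Fin n} {ys} → Unique ys → All (_≡ w) ys → w ∈ ys → length ys ≡ 1
length≡1 {ys = _ ∷ []}    _                  _               _ = refl
length≡1 {ys = _ ∷ _ ∷ _} ((y≢z ∷ _) ∷ _) (y≡w ∷ z≡w ∷ _) _ = contradiction (trans y≡w (sym z≡w)) y≢z

AllPairs-mapWith-All : ∀ {A : Set} {P : A → Set} {R R′ : A → A → Set} →
                       (∀ {x y} → P x → P y → R x y → R′ x y) →
                       ∀ {xs} → All P xs → AllPairs R xs → AllPairs R′ xs
AllPairs-mapWith-All f []         []         = []
AllPairs-mapWith-All f (px ∷ pxs) (rx ∷ rxs) =
  All.zipWith (λ (py , r) → f px py r) (pxs , rx) ∷ AllPairs-mapWith-All f pxs rxs

module _ {n : ℕ} where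

  open import Data.List.Membership.DecPropositional (_≟_ {n}) using (_∈?_)

  private
    path-from-suffix : ∀ {R : Fin n → Fin n → Set} {a b z zs} → a ∈ z ∷ zs →
                       Unique (z ∷ zs) → Linked R (z ∷ zs) → lastOf z zs ≡ b →
                       ∃[ ws ] (Unique (a ∷ ws) × Linked R (a ∷ ws) × lastOf a ws ≡ b)
    path-from-suffix {zs = zs}      (here refl) !zs R-zs end = zs , !zs , R-zs , end
    path-from-suffix {zs = _ ∷ _} (there a∈zs) (_ ∷ !zs) (_ ∷ R-zs) end = path-from-suffix a∈zs !zs R-zs end

  -- loop erasure
  star⇒path : ∀ {R : Fin n → Fin n → Set} {a b} → Star R a b →
              ∃[ xs ] (Unique (a ∷ xs) × Linked R (a ∷ xs) × lastOf a xs ≡ b)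
  star⇒path ε = [] , [] ∷ [] , [-] , refl
  star⇒path {a = a} (Rab ◅ walk) with star⇒path walk
  ... | ys , !ys , R-ys , end with a ∈? _
  ...   | yes a∈ys = path-from-suffix a∈ys !ys R-ys end
  ...   | no  a∉ys = _ , All.¬Any⇒All¬ _ a∉ys ∷ !ys , Rab ∷ R-ys , end

  Linked-snoc : ∀ {R : Fin n → Fin n → Set} {x y} xs → Linked R (x ∷ xs) → R (lastOf x xs) y →
                Linked R (x ∷ xs ++ y ∷ [])
  Linked-snoc []       _            Rxy = Rxy ∷ [-]
  Linked-snoc (_ ∷ xs) (Rxz ∷ R-xs) Rzy = Rxz ∷ Linked-snoc xs R-xs Rzy

  Avoiding : (Fin n → Fin n → Set) → Fin n → Fin n → Fin n → Fin n → Set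
  Avoiding R a b x y = R x y × ¬ (x ≡ a × y ≡ b) × ¬ (x ≡ b × y ≡ a)

  walk⇒cycle : ∀ {R : Fin n → Fin n → Set} {a b} → a ≢ b → R b a → Star (Avoiding R a b) a b → HasCycle R
  walk⇒cycle {R} {a} a≢b Rba walk with star⇒path walk
  ... | []            , _   , _                  , end = contradiction end a≢b
  ... | _ ∷ []        , _   , ((_ , ¬ab , _) ∷ _) , end = contradiction (refl , end) ¬ab
  ... | xs@(_ ∷ _ ∷ _) , !xs , R-xs              , end =
    _ , xs , s≤s (s≤s z≤n) , !xs , Linked-snoc xs (Linked.map proj₁ R-xs) (subst (λ z → R z a) (sym end) Rba)

-- Breadth-first layering of a tree

least : ∀ {P : ℕ → Set} → (∀ k → Dec (P k)) → ∀ {k} → P k → ∃[ m ] (P m × (∀ {j} → j < m → ¬ P j))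
least P? {zero} P0 = 0 , P0 , λ ()
least P? {suc k} Pk with P? 0
... | yes P0 = 0 , P0 , λ ()
... | no ¬P0 with least (P? ∘ suc) Pk
...   | m , Pm , below = suc m , Pm , λ { {zero} _ → ¬P0 ; {suc j} j<m → below (s≤s⁻¹ j<m) }

module RootedTree {n} (E : Fin n → Fin n → Bool) (E-sym : ∀ u v → E u v ≡ E v u)
                  (E-tree : IsTree (λ u v → E u v ≡ true)) (r : Fin n) where

  _~_ : Fin n → Fin n → Set
  u ~ v = E u v ≡ true

  ~-sym : ∀ {u v} → u ~ v → v ~ u
  ~-sym {u} {v} u~v = trans (E-sym v u) u~v

  Reach : ℕ → Fin n → Set
  Reach zero    v = v ≡ r
  Reach (suc k) v = Reach k v ⊎ ∃[ u ] (Reach k u × u ~ v)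

  reach? : ∀ k v → Dec (Reach k v)
  reach? zero    v = v ≟ r
  reach? (suc k) v = reach? k v ⊎-dec any? (λ u → reach? k u ×-dec (E u v Bool.≟ true))

  reach-walk : ∀ {k u v} → Reach k u → Star _~_ u v → ∃[ m ] Reach m v
  reach-walk {k} R-u ε           = k , R-u
  reach-walk     R-u (u~w ◅ walk) = reach-walk (inj₂ (_ , R-u , u~w)) walk

  depth-spec : ∀ v → ∃[ m ] (Reach m v × ∀ {j} → j < m → ¬ Reach j v)
  depth-spec v = least (λ k → reach? k v) (proj₂ (reach-walk {0} refl (proj₁ E-tree r v)))

  depth : Fin n → ℕ
  depth v = proj₁ (depth-spec v)

  reach-depth : ∀ v → Reach (depth v) v
  reach-depth v = proj₁ (proj₂ (depth-spec v))

  depth-minimal : ∀ {k v} → Reach k v → depth v ≤ k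
  depth-minimal {k} {v} R-v = ≮⇒≥ λ k<d → proj₂ (proj₂ (depth-spec v)) k<d R-v

  depth-root : depth r ≡ 0
  depth-root = n≤0⇒n≡0 (depth-minimal {0} refl)

  depth≡0⇒root : ∀ {v} → depth v ≡ 0 → v ≡ r
  depth≡0⇒root {v} d≡0 = subst (λ k → Reach k v) d≡0 (reach-depth v)

  depth≡suc⇒≢root : ∀ {v k} → depth v ≡ suc k → v ≢ r
  depth≡suc⇒≢root d≡suc refl = 0≢1+n (trans (sym depth-root) d≡suc)

  depth-edge : ∀ {u v} → u ~ v → depth v ≤ suc (depth u)
  depth-edge {u} u~v = depth-minimal (inj₂ (u , reach-depth u , u~v))

  parent-spec : ∀ v → v ≢ r → ∃[ u ] (u ~ v × suc (depth u) ≡ depth v)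
  parent-spec v v≢r with depth v in d≡ | reach-depth v
  ... | zero  | _ = contradiction (depth≡0⇒root d≡) v≢r
  ... | suc k | inj₁ R-k    = contradiction (subst (_≤ k) d≡ (depth-minimal R-k)) (<-irrefl refl)
  ... | suc k | inj₂ (u , R-u , u~v) =
    u , u~v , cong suc (≤-antisym (depth-minimal R-u) (s≤s⁻¹ (subst (_≤ suc (depth u)) d≡ (depth-edge u~v))))

  parent : Fin n → Fin n
  parent v with v ≟ r
  ... | yes _   = r
  ... | no v≢r = proj₁ (parent-spec v v≢r)

  parent-edge : ∀ {v} → v ≢ r → parent v ~ v × suc (depth (parent v)) ≡ depth v
  parent-edge {v} v≢r with v ≟ r
  ... | yes v≡r  = contradiction v≡r v≢r
  ... | no  v≢r′ = proj₂ (parent-spec v v≢r′)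

  Descent : ℕ → Fin n → Fin n → Set
  Descent c x y = x ~ y × depth y < depth x × depth x ≤ c

  descent-to-root : ∀ {c} k v → depth v ≡ k → depth v ≤ c → Star (Descent c) v r
  descent-to-root zero    v d≡0 _   rewrite depth≡0⇒root d≡0 = ε
  descent-to-root (suc k) v d≡k d≤c =
    (~-sym p~v , subst (depth (parent v) <_) pd≡d ≤-refl , d≤c)
    ◅ descent-to-root k (parent v) (suc-injective (trans pd≡d d≡k)) (≤-trans (n≤1+n _) (subst (_≤ _) (sym pd≡d) d≤c))
    where
    p~v = proj₁ (parent-edge (depth≡suc⇒≢root d≡k))
    pd≡d = proj₂ (parent-edge (depth≡suc⇒≢root d≡k))

  descent : ∀ v → Star (Descent (depth v)) v r
  descent v = descent-to-root _ v refl ≤-refl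

  -- the descents to r from the two ends of an edge between equal depths close a cycle
  no-level-edge : ∀ {u v} → u ~ v → u ≢ v → depth u ≢ depth v
  no-level-edge {u} {v} u~v u≢v du≡dv = proj₂ E-tree (walk⇒cycle u≢v (~-sym u~v) (down ◅◅ up))
    where
    avoid↓ : ∀ {x y} → Descent (depth u) x y → Avoiding _~_ u v x y
    avoid↓ (x~y , dy<dx , _) = x~y , (λ { (refl , refl) → <-irrefl (sym du≡dv) dy<dx })
                                   , (λ { (refl , refl) → <-irrefl du≡dv dy<dx })
    avoid↑ : ∀ {x y} → Descent (depth v) x y → Avoiding _~_ u v y x
    avoid↑ (x~y , dy<dx , _) = ~-sym x~y , (λ { (refl , refl) → <-irrefl du≡dv dy<dx })
                                         , (λ { (refl , refl) → <-irrefl (sym du≡dv) dy<dx })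
    down = Star.map avoid↓ (descent u)
    up   = Star.reverse avoid↑ (descent v)

  -- otherwise w, the parent of v and a common ancestor close a cycle through v
  parent-unique : ∀ {w v} → w ~ v → suc (depth w) ≡ depth v → w ≡ parent v
  parent-unique {w} {v} w~v dv≡ with w ≟ parent v
  ... | yes w≡p = w≡p
  ... | no  w≢p = contradiction (walk⇒cycle v≢w w~v (first ◅ (down ◅◅ up))) (proj₂ E-tree)
    where
    v≢r = depth≡suc⇒≢root (sym dv≡)
    p~v = proj₁ (parent-edge v≢r)
    dp≡dw : depth (parent v) ≡ depth w
    dp≡dw = suc-injective (trans (proj₂ (parent-edge v≢r)) (sym dv≡))
    v≢w : v ≢ w
    v≢w refl = <-irrefl refl (subst (suc (depth v) ≤_) dv≡ ≤-refl)
    ≢v : ∀ {x} → depth x ≤ depth w → x ≢ v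
    ≢v dx≤dw refl = <-irrefl refl (subst (_≤ depth w) (sym dv≡) dx≤dw)
    first : Avoiding _~_ v w v (parent v)
    first = ~-sym p~v , (λ { (_ , refl) → w≢p refl }) , (λ { (refl , _) → v≢w refl })
    avoid↓ : ∀ {x y} → Descent (depth w) x y → Avoiding _~_ v w x y
    avoid↓ (x~y , dy<dx , dx≤dw) = x~y , (λ { (refl , _) → ≢v dx≤dw refl })
                                       , (λ { (_ , refl) → ≢v (≤-trans (<⇒≤ dy<dx) dx≤dw) refl })
    avoid↑ : ∀ {x y} → Descent (depth w) x y → Avoiding _~_ v w y x
    avoid↑ (x~y , dy<dx , dx≤dw) = ~-sym x~y , (λ { (refl , _) → ≢v (≤-trans (<⇒≤ dy<dx) dx≤dw) refl })
                                             , (λ { (_ , refl) → ≢v dx≤dw refl })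
    down = Star.map avoid↓ (descent-to-root _ (parent v) refl (≤-reflexive dp≡dw))
    up   = Star.reverse avoid↑ (descent w)

  edge-orientation : ∀ {u v} → u ~ v → u ≢ v → (u ≢ r × v ≡ parent u) ⊎ (v ≢ r × u ≡ parent v)
  edge-orientation {u} {v} u~v u≢v with <-cmp (depth u) (depth v)
  ... | tri≈ _ du≡dv _ = contradiction du≡dv (no-level-edge u~v u≢v)
  ... | tri< du<dv _ _ = inj₂ (depth≡suc⇒≢root (sym dv≡) , parent-unique u~v dv≡)
    where dv≡ = ≤-antisym du<dv (depth-edge u~v)
  ... | tri> _ _ du>dv = inj₁ (depth≡suc⇒≢root (sym du≡) , parent-unique (~-sym u~v) du≡)
    where du≡ = ≤-antisym du>dv (depth-edge (~-sym u~v))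

  hasParent : Fin n → Fin n → Bool
  hasParent u v = does (parent u ≟ v) ∧ not (does (u ≟ r))

  hasParent-true : ∀ {u v} → hasParent u v ≡ true → u ≢ r × v ≡ parent u
  hasParent-true {u} {v} h with p≡v , u≢r ← ∧-true h = does-false (u ≟ r) u≢r , sym (does-true (parent u ≟ v) p≡v)

  hasParent-parent : ∀ {u} → u ≢ r → hasParent u (parent u) ≡ true
  hasParent-parent {u} u≢r rewrite dec-true (parent u ≟ parent u) refl | dec-false (u ≟ r) u≢r = refl

  parent-depth< : ∀ {u} → u ≢ r → depth (parent u) < depth u
  parent-depth< u≢r = ≤-reflexive (proj₂ (parent-edge u≢r))

  parent-~ : ∀ {u} → u ≢ r → u ~ parent u
  parent-~ u≢r = ~-sym (proj₁ (parent-edge u≢r))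

  pair-split : ∀ (Q : Fin n → Fin n → Bool) → (∀ u v → Q u v ≡ Q v u) → ∀ u v →
               𝟙 (not (does (u ≟ v)) ∧ (E u v ∧ Q u v)) ≡ 𝟙 (hasParent u v ∧ Q u v) + 𝟙 (hasParent v u ∧ Q v u)
  pair-split Q Q-sym u v with hasParent u v in h₁ | hasParent v u in h₂
  ... | true  | true  with u≢r , refl ← hasParent-true {u} {v} h₁ | v≢r , u≡pv ← hasParent-true {v} {u} h₂ =
    contradiction (parent-depth< u≢r) (<-asym (subst (λ x → depth x < depth (parent u)) (sym u≡pv) (parent-depth< v≢r)))
  ... | true  | false with u≢r , refl ← hasParent-true {u} {v} h₁
    rewrite dec-false (u ≟ parent u) (λ u≡p → <-irrefl (cong depth (sym u≡p)) (parent-depth< u≢r)) | parent-~ u≢r =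
    sym (+-identityʳ _)
  ... | false | true  with v≢r , refl ← hasParent-true {v} {u} h₂
    rewrite dec-false (parent v ≟ v) (λ p≡v → <-irrefl (cong depth p≡v) (parent-depth< v≢r)) | ~-sym (parent-~ v≢r) =
    cong 𝟙 (Q-sym (parent v) v)
  ... | false | false with u ≟ v
  ...   | yes _   = refl
  ...   | no  u≢v with E u v in u~v
  ...     | false = refl
  ...     | true with edge-orientation u~v u≢v
  ...       | inj₁ (u≢r , refl) with () ← trans (sym h₁) (hasParent-parent u≢r)
  ...       | inj₂ (v≢r , refl) with () ← trans (sym h₂) (hasParent-parent v≢r)

  ∑-hasParent : ∀ (f : Fin n → Fin n → Bool) →
                ∑[ u < n ] ∑[ v < n ] 𝟙 (hasParent u v ∧ f u v)
                  ≡ ∑[ u < n ] 𝟙 (not (does (u ≟ r)) ∧ f u (parent u))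
  ∑-hasParent f = sum-cong-≗ λ u →
    trans (sum-cong-≗ λ v → cong 𝟙 (Bool.∧-assoc (does (parent u ≟ v)) _ _)) (∑-𝟙-point (parent u) _)

  pairCount-tree : ∀ (Q : Fin n → Fin n → Bool) → (∀ u v → Q u v ≡ Q v u) →
                   pairCount (λ u v → E u v ∧ Q u v) ≡ 2 * ∑[ u < n ] 𝟙 (not (does (u ≟ r)) ∧ Q u (parent u))
  pairCount-tree Q Q-sym = begin
    pairCount (λ u v → E u v ∧ Q u v)
      ≡⟨ sum-cong-≗ (λ u → sum-cong-≗ (pair-split Q Q-sym u)) ⟩
    ∑[ u < n ] ∑[ v < n ] (A u v + A v u)
      ≡⟨ ∑∑-symmetrize A ⟩
    2 * ∑[ u < n ] ∑[ v < n ] A u v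
      ≡⟨ cong (2 *_) (∑-hasParent Q) ⟩
    2 * ∑[ u < n ] 𝟙 (not (does (u ≟ r)) ∧ Q u (parent u)) ∎
    where
    open ≡-Reasoning
    A : Fin n → Fin n → ℕ
    A u v = 𝟙 (hasParent u v ∧ Q u v)

  pairCount-edges : pairCount E ≡ 2 * ∑[ u < n ] 𝟙 (not (does (u ≟ r)))
  pairCount-edges = begin
    pairCount E                                    ≡⟨ pairCount-cong (λ u v → Bool.∧-identityʳ (E u v)) ⟨
    pairCount (λ u v → E u v ∧ true)               ≡⟨ pairCount-tree (λ _ _ → true) (λ _ _ → refl) ⟩
    2 * ∑[ u < n ] 𝟙 (nonroot u ∧ true)            ≡⟨ cong (2 *_) (sum-cong-≗ (cong 𝟙 ∘ Bool.∧-identityʳ ∘ nonroot)) ⟩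
    2 * ∑[ u < n ] 𝟙 (nonroot u)                   ∎
    where
    open ≡-Reasoning
    nonroot : Fin n → Bool
    nonroot u = not (does (u ≟ r))

-- Plane trees

module RootedPlaneTree {n} (ρ : Rotation n) (ρ-plane : IsPlaneTree ρ) (r : Fin n) where

  open import Data.List.Membership.DecPropositional (_≟_ {n}) using (_∈?_)

  private
    ρ-unique = proj₁ ρ-plane
    ρ-irrefl = proj₁ (proj₂ ρ-plane)
    ρ-sym    = proj₁ (proj₂ (proj₂ ρ-plane))
    ρ-tree   = proj₂ (proj₂ (proj₂ ρ-plane))

  ET : Fin n → Fin n → Bool
  ET u v = does (v ∈? ρ u)

  ET-true : ∀ {u v} → ET u v ≡ true → v ∈ ρ u
  ET-true {u} {v} = does-true (v ∈? ρ u)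

  ET-intro : ∀ {u v} → v ∈ ρ u → ET u v ≡ true
  ET-intro {u} {v} = dec-true (v ∈? ρ u)

  ET-irrefl : ∀ u → ET u u ≡ false
  ET-irrefl u = dec-false (u ∈? ρ u) (ρ-irrefl u)

  ET-sym : ∀ u v → ET u v ≡ ET v u
  ET-sym u v = does-⇔ (mk⇔ (ρ-sym u v) (ρ-sym v u)) (v ∈? ρ u) (u ∈? ρ v)

  ET-tree : IsTree (λ u v → ET u v ≡ true)
  ET-tree = (λ u v → Star.map ET-intro (proj₁ ρ-tree u v))
          , (λ (x , xs , 2≤ , !xs , T-xs) → proj₂ ρ-tree (x , xs , 2≤ , !xs , Linked.map ET-true T-xs))

  open RootedTree ET ET-sym ET-tree r public

  ancestorsOf : ℕ → Fin n → List (Fin n)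
  ancestorsOf zero    x = []
  ancestorsOf (suc k) x = x ∷ ancestorsOf k (parent x)

  -- x, parent x, ..., up to but excluding r
  ancestors : Fin n → List (Fin n)
  ancestors x = ancestorsOf (depth x) x

  ancestors-root : ancestors r ≡ []
  ancestors-root = cong (λ k → ancestorsOf k r) depth-root

  ancestors-step : ∀ {x} → x ≢ r → ancestors x ≡ x ∷ ancestors (parent x)
  ancestors-step x≢r = cong (λ k → ancestorsOf k _) (sym (proj₂ (parent-edge x≢r)))

  length-ancestorsOf : ∀ k x → length (ancestorsOf k x) ≡ k
  length-ancestorsOf zero    x = refl
  length-ancestorsOf (suc k) x = cong suc (length-ancestorsOf k (parent x))

  length-ancestors : ∀ x → length (ancestors x) ≡ depth x
  length-ancestors x = length-ancestorsOf (depth x) x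

  Ascent : Fin n → Fin n → Set
  Ascent x y = y ∈ ρ x × depth x < depth y

  ascent-from-root : ∀ k x → depth x ≡ k → ∃[ xs ] (Linked Ascent (r ∷ xs) × length xs ≡ k × lastOf r xs ≡ x)
  ascent-from-root zero    x d≡0 = [] , [-] , refl , sym (depth≡0⇒root d≡0)
  ascent-from-root (suc k) x d≡k =
    let x≢r = depth≡suc⇒≢root d≡k
        xs , asc , len , end = ascent-from-root k (parent x) (suc-injective (trans (proj₂ (parent-edge x≢r)) d≡k))
    in xs ++ x ∷ []
     , Linked-snoc xs asc (subst (λ y → Ascent y x) (sym end) (ET-true (proj₁ (parent-edge x≢r)) , parent-depth< x≢r))
     , trans (length-++ xs) (trans (+-comm (length xs) 1) (cong suc len))
     , lastOf-snoc r x xs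

  root-path : ∀ x → Path (AdjT ρ) r x (depth x)
  root-path x with xs , asc , len , end ← ascent-from-root (depth x) x refl =
    xs , AllPairs.map (λ d< d≡ → <-irrefl (cong depth d≡) d<) (Linked.Linked⇒AllPairs <-trans (Linked.map proj₂ asc))
       , Linked.map proj₁ asc , len , end

  -- all neighbours of a deepest vertex are shallower, hence its parent
  deepest-leaf : ∀ {x} → x ≢ r → (∀ y → depth y ≤ depth x) → IsLeaf ρ x
  deepest-leaf {x} x≢r x-deepest = length≡1 (ρ-unique x) (All.tabulate neighbour-parent) (ET-true (parent-~ x≢r))
    where
    neighbour-parent : ∀ {y} → y ∈ ρ x → y ≡ parent x
    neighbour-parent {y} y∈ρ with edge-orientation (ET-intro y∈ρ) (λ { refl → ρ-irrefl _ y∈ρ })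
    ... | inj₁ (_ , y≡p)    = y≡p
    ... | inj₂ (y≢r , x≡p) =
      contradiction (x-deepest y) (<⇒≱ (subst (λ z → depth z < depth y) (sym x≡p) (parent-depth< y≢r)))

  deepest : Fin n
  deepest = argmax depth r (allFin n)

  depth≤deepest : ∀ x → depth x ≤ depth deepest
  depth≤deepest x = All.lookup (f[xs]≤f[argmax] r (allFin n)) (∈-allFin x)

  depth-bounded : ∀ {d} → IsDepth ρ r d → ∀ x → depth x ≤ d
  depth-bounded {d} (leaf-bound , _) x = through deepest depth≤deepest
    where
    through : ∀ x* → (∀ y → depth y ≤ depth x*) → depth x ≤ d
    through x* x*-deepest with x* ≟ r
    ... | yes refl = ≤-trans (x*-deepest x) (≤-trans (≤-reflexive depth-root) z≤n)
    ... | no  x*≢r = ≤-trans (x*-deepest x) (leaf-bound x* (depth x*) (deepest-leaf x*≢r x*-deepest) (root-path x*))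

  1≤depth-bound : ∀ {v d} → v ≢ r → IsDepth ρ r d → 1 ≤ d
  1≤depth-bound {v} v≢r D = ≤-trans (n≢0⇒n>0 (v≢r ∘ depth≡0⇒root)) (depth-bounded D v)

-- Spanning trees of H with prescribed cycle edges

module CycleEdgeSelection {n} (ρ : Rotation n) (ρ-plane : IsPlaneTree ρ) (r : Fin n)
                          (S : Subset n) (S-leaves : (l : Fin n) → l ∈ₛ S → IsLeaf ρ l) where

  open RootedPlaneTree ρ ρ-plane r
  open import Data.List.Membership.DecPropositional (_≟_ {n}) using (_∈?_)

  next : Fin n → Fin n
  next = nextLeaf ρ

  Selected : Fin n → Fin n → Set
  Selected u v = (u ∈ₛ S × next u ≡ v) ⊎ (v ∈ₛ S × next v ≡ u)

  selected? : ∀ u v → Dec (Selected u v)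
  selected? u v = (u Subset.∈? S ×-dec next u ≟ v) ⊎-dec (v Subset.∈? S ×-dec next v ≟ u)

  selected⇒AdjC : ∀ {u v} → Selected u v → AdjC ρ u v
  selected⇒AdjC (inj₁ (u∈S , eq)) = inj₁ (S-leaves _ u∈S , eq)
  selected⇒AdjC (inj₂ (v∈S , eq)) = inj₂ (S-leaves _ v∈S , eq)

  Admissible : EdgeSet n → Set
  Admissible F = IsSpanningTreeOfH ρ F × ((u v : Fin n) → AdjC ρ u v → (F u v ≡ true) ⇔ Selected u v)

  -- the tree edges {a , parent a} missing from F, indexed by their lower end a
  deleted : EdgeSet n → Fin n → Bool
  deleted F a = not (does (a ≟ r)) ∧ not (F a (parent a))

  deleted-nonroot : ∀ F {a} → a ≢ r → deleted F a ≡ not (F a (parent a))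
  deleted-nonroot F {a} a≢r = cong (λ b → not b ∧ not (F a (parent a))) (dec-false (a ≟ r) a≢r)

  deleted≡⇒≡ : ∀ F G {a} → a ≢ r → deleted F a ≡ deleted G a → F a (parent a) ≡ G a (parent a)
  deleted≡⇒≡ F G a≢r eq = Bool.not-injective (trans (sym (deleted-nonroot F a≢r)) (trans eq (deleted-nonroot G a≢r)))

  -- the number of selected edges outside T, counted in both orientations
  K : ℕ
  K = pairCount (λ u v → not (ET u v) ∧ does (selected? u v))

  Covered : Fin n → Fin n → Set
  Covered a l = l ∈ₛ S × (a ∈ ancestors l ⊎ a ∈ ancestors (next l))

  covered? : ∀ a l → Dec (Covered a l)
  covered? a l = l Subset.∈? S ×-dec (a ∈? ancestors l ⊎-dec a ∈? ancestors (next l))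

  covered : Fin n → Bool
  covered a = does (any? (covered? a))

  module _ {F : EdgeSet n} (adm : Admissible F) where

    private
      F-sym   = proj₁ (proj₁ adm)
      F-in-H  = proj₁ (proj₂ (proj₁ adm))
      F-tree  = proj₂ (proj₂ (proj₁ adm))
      F-cycle = proj₂ adm

    F-off-T : ∀ {u v} → ET u v ≡ false → F u v ≡ does (selected? u v)
    F-off-T {u} {v} ET≡f =
      ≡-does (selected? u v) (mk⇔ F⇒selected λ sel → Equivalence.from (F-cycle u v (selected⇒AdjC sel)) sel)
      where
      F⇒selected : F u v ≡ true → Selected u v
      F⇒selected F≡ with F-in-H u v F≡
      ... | inj₁ uv∈T = contradiction (trans (sym (ET-intro uv∈T)) ET≡f) λ ()
      ... | inj₂ uv∈C = Equivalence.to (F-cycle u v uv∈C) F≡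

    -- T and F have the same number of edges
    2*∣deleted∣ᵇ≡K : 2 * ∣ deleted F ∣ᵇ ≡ K
    2*∣deleted∣ᵇ≡K = begin
      2 * ∣ deleted F ∣ᵇ
        ≡⟨ pairCount-tree (λ u v → not (F u v)) (λ u v → cong not (F-sym u v)) ⟨
      pairCount (λ u v → ET u v ∧ not (F u v))
        ≡⟨ +-cancelˡ-≡ (pairCount (λ u v → ET u v ∧ F u v)) _ _ same-size ⟩
      pairCount (λ u v → F u v ∧ not (ET u v))
        ≡⟨ pairCount-cong off-T ⟩
      K ∎
      where
      open ≡-Reasoning
      module FT = RootedTree F F-sym F-tree r
      same-size : pairCount (λ u v → ET u v ∧ F u v) + pairCount (λ u v → ET u v ∧ not (F u v))
                ≡ pairCount (λ u v → ET u v ∧ F u v) + pairCount (λ u v → F u v ∧ not (ET u v))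
      same-size = begin
        A + pairCount (λ u v → ET u v ∧ not (F u v))  ≡⟨ pairCount-split ET F ⟨
        pairCount ET                                 ≡⟨ trans pairCount-edges (sym FT.pairCount-edges) ⟩
        pairCount F                                  ≡⟨ pairCount-split F ET ⟩
        pairCount (λ u v → F u v ∧ ET u v) + B       ≡⟨ cong (_+ B) (pairCount-cong (λ u v → Bool.∧-comm (F u v) _)) ⟩
        A + B                                        ∎
        where
        A = pairCount (λ u v → ET u v ∧ F u v)
        B = pairCount (λ u v → F u v ∧ not (ET u v))
      off-T : ∀ u v → (F u v ∧ not (ET u v)) ≡ (not (ET u v) ∧ does (selected? u v))
      off-T u v with ET u v in ET≡
      ... | true  = Bool.∧-zeroʳ (F u v)
      ... | false = trans (Bool.∧-identityʳ (F u v)) (F-off-T ET≡)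

    deleted⊆covered : deleted F ⊆ᵇ covered
    deleted⊆covered a del with any? (covered? a)
    ... | yes _ = refl
    ... | no ¬covered =
      contradiction (subst (a ∈_) (sym (ancestors-step a≢r)) (here refl)) (a∉-walk (proj₁ F-tree r a) a∉root)
      where
      a≢r = does-false (a ≟ r) (proj₁ (∧-true del))
      F-pa = Bool.not-injective (proj₂ (∧-true del))
      a∉root : ¬ a ∈ ancestors r
      a∉root a∈ with () ← subst (a ∈_) ancestors-root a∈
      tree-step : ∀ {x y} → ET x y ≡ true → F x y ≡ true → ¬ a ∈ ancestors x → ¬ a ∈ ancestors y
      tree-step {x} {y} ET≡ Fxy a∉x with edge-orientation ET≡ (λ { refl → case trans (sym ET≡) (ET-irrefl x) of λ () })
      ... | inj₁ (x≢r , y≡px) = λ a∈y →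
        a∉x (subst (a ∈_) (sym (ancestors-step x≢r)) (there (subst (λ z → a ∈ ancestors z) y≡px a∈y)))
      ... | inj₂ (y≢r , x≡py) = λ a∈y → case subst (a ∈_) (ancestors-step y≢r) a∈y of λ
        { (here refl)  → contradiction (trans (sym F-pa) (trans (cong (F y) (sym x≡py)) (trans (F-sym y x) Fxy))) λ ()
        ; (there a∈px) → a∉x (subst (λ z → a ∈ ancestors z) (sym x≡py) a∈px) }
      selected-step : ∀ {x y} → Selected x y → ¬ a ∈ ancestors y
      selected-step {x} (inj₁ (x∈S , y≡)) a∈y =
        ¬covered (x , x∈S , inj₂ (subst (λ z → a ∈ ancestors z) (sym y≡) a∈y))
      selected-step {y = y} (inj₂ (y∈S , _)) a∈y = ¬covered (y , y∈S , inj₁ a∈y)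
      a∉-step : ∀ {x y} → F x y ≡ true → ¬ a ∈ ancestors x → ¬ a ∈ ancestors y
      a∉-step {x} {y} Fxy a∉x with ET x y in ET≡
      ... | true  = tree-step ET≡ Fxy a∉x
      ... | false = selected-step (does-true (selected? x y) (trans (sym (F-off-T ET≡)) Fxy))
      a∉-walk : ∀ {x y} → Star (λ u v → F u v ≡ true) x y → ¬ a ∈ ancestors x → ¬ a ∈ ancestors y
      a∉-walk ε              a∉x = a∉x
      a∉-walk (Fxz ◅ walk) a∉x = a∉-walk walk (a∉-step Fxz a∉x)

  ∣covered∣ᵇ≤ : ∀ {d} → IsDepth ρ r d → ∣ covered ∣ᵇ ≤ ∣ S ∣ * (2 * d)
  ∣covered∣ᵇ≤ {d} D = begin
    ∑[ a < n ] 𝟙 (covered a)                          ≤⟨ ∑-mono-≤ (λ a → 𝟙-any≤∑ (covered? a)) ⟩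
    ∑[ a < n ] ∑[ l < n ] 𝟙 (does (covered? a l))     ≡⟨ ∑-comm (λ a l → 𝟙 (does (covered? a l))) ⟩
    ∑[ l < n ] ∑[ a < n ] 𝟙 (does (covered? a l))     ≤⟨ ∑-mono-≤ per-leaf ⟩
    ∑[ l < n ] (𝟙 (does (l Subset.∈? S)) * (2 * d))   ≡⟨ *-distribʳ-sum (2 * d) (𝟙 ∘ does ∘ (Subset._∈? S)) ⟨
    ∣ (λ l → does (l Subset.∈? S)) ∣ᵇ * (2 * d)        ≡⟨ cong (_* (2 * d)) (∣p∣≡∣∈?∣ᵇ S) ⟨
    ∣ S ∣ * (2 * d)                                   ∎
    where
    open ≤-Reasoning
    ∣ancestors∣ᵇ≤ : ∀ x → ∑[ a < n ] 𝟙 (does (a ∈? ancestors x)) ≤ d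
    ∣ancestors∣ᵇ≤ x = begin
      ∑[ a < n ] 𝟙 (does (a ∈? ancestors x))  ≤⟨ ∣∈?∣ᵇ≤length (ancestors x) ⟩
      length (ancestors x)                    ≡⟨ length-ancestors x ⟩
      depth x                                 ≤⟨ depth-bounded D x ⟩
      d                                       ∎
    per-leaf : ∀ l → ∑[ a < n ] 𝟙 (does (covered? a l)) ≤ 𝟙 (does (l Subset.∈? S)) * (2 * d)
    per-leaf l with does (l Subset.∈? S)
    ... | false = ≤-reflexive (sum-replicate-zero n)
    ... | true  = begin
      ∑[ a < n ] 𝟙 (does (a ∈? ancestors l) ∨ does (a ∈? ancestors (next l)))
        ≤⟨ ∑-mono-≤ (λ a → 𝟙-∨ (does (a ∈? ancestors l)) _) ⟩
      ∑[ a < n ] (𝟙 (does (a ∈? ancestors l)) + 𝟙 (does (a ∈? ancestors (next l))))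
        ≡⟨ ∑-distrib-+ (λ a → 𝟙 (does (a ∈? ancestors l))) _ ⟩
      ∑[ a < n ] 𝟙 (does (a ∈? ancestors l)) + ∑[ a < n ] 𝟙 (does (a ∈? ancestors (next l)))
        ≤⟨ +-mono-≤ (∣ancestors∣ᵇ≤ l) (∣ancestors∣ᵇ≤ (next l)) ⟩
      d + d
        ≡⟨ trans (*-identityˡ (2 * d)) (cong (d +_) (+-identityʳ d)) ⟨
      1 * (2 * d) ∎

  K≤2∣S∣ : K ≤ 2 * ∣ S ∣
  K≤2∣S∣ = begin
    K                                     ≤⟨ ∑-mono-≤ (λ u → ∑-mono-≤ (λ v → pair-bound u v)) ⟩
    ∑[ u < n ] ∑[ v < n ] (e u v + e v u)  ≡⟨ ∑∑-symmetrize e ⟩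
    2 * ∑[ u < n ] ∑[ v < n ] e u v        ≡⟨ cong (2 *_) (sum-cong-≗ λ u → ∑-𝟙-point (next u) _) ⟩
    2 * ∣ (λ u → does (u Subset.∈? S)) ∣ᵇ  ≡⟨ cong (2 *_) (∣p∣≡∣∈?∣ᵇ S) ⟨
    2 * ∣ S ∣                             ∎
    where
    open ≤-Reasoning
    e : Fin n → Fin n → ℕ
    e u v = 𝟙 (does (next u ≟ v) ∧ does (u Subset.∈? S))
    pair-bound : ∀ u v → 𝟙 (not (does (u ≟ v)) ∧ (not (ET u v) ∧ does (selected? u v))) ≤ e u v + e v u
    pair-bound u v = begin
      𝟙 (not (does (u ≟ v)) ∧ (not (ET u v) ∧ does (selected? u v)))  ≤⟨ 𝟙-∧≤ʳ (not (does (u ≟ v))) _ ⟩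
      𝟙 (not (ET u v) ∧ does (selected? u v))                          ≤⟨ 𝟙-∧≤ʳ (not (ET u v)) _ ⟩
      𝟙 (su ∧ nu ∨ sv ∧ nv)                                            ≤⟨ 𝟙-∨ (su ∧ nu) (sv ∧ nv) ⟩
      𝟙 (su ∧ nu) + 𝟙 (sv ∧ nv)
        ≡⟨ cong₂ _+_ (cong 𝟙 (Bool.∧-comm su nu)) (cong 𝟙 (Bool.∧-comm sv nv)) ⟩
      e u v + e v u                                                    ∎
      where
      su = does (u Subset.∈? S)
      sv = does (v Subset.∈? S)
      nu = does (next u ≟ v)
      nv = does (next v ≟ u)

  K/2≤∣S∣ : K / 2 ≤ ∣ S ∣
  K/2≤∣S∣ = begin
    K / 2            ≤⟨ /-monoˡ-≤ 2 K≤2∣S∣ ⟩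
    2 * ∣ S ∣ / 2    ≡⟨ cong (_/ 2) (*-comm 2 ∣ S ∣) ⟩
    ∣ S ∣ * 2 / 2    ≡⟨ m*n/n≡m ∣ S ∣ 2 ⟩
    ∣ S ∣            ∎
    where open ≤-Reasoning

  ∣deleted∣ᵇ≡K/2 : ∀ {F} → Admissible F → ∣ deleted F ∣ᵇ ≡ K / 2
  ∣deleted∣ᵇ≡K/2 {F} adm =
    trans (sym (m*n/n≡m ∣ deleted F ∣ᵇ 2)) (cong (_/ 2) (trans (*-comm ∣ deleted F ∣ᵇ 2) (2*∣deleted∣ᵇ≡K adm)))

  deleted-differs : ∀ {F G} → Admissible F → Admissible G → Differ F G → Differs (deleted F) (deleted G)
  deleted-differs {F} {G} F-adm G-adm (u , v , F≢G) with ET u v in ET≡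
  ... | false = contradiction (trans (F-off-T F-adm ET≡) (sym (F-off-T G-adm ET≡))) F≢G
  ... | true with edge-orientation ET≡ (λ { refl → contradiction (trans (sym ET≡) (ET-irrefl u)) λ () })
  ...   | inj₁ (u≢r , refl) = u , F≢G ∘ deleted≡⇒≡ F G u≢r
  ...   | inj₂ (v≢r , refl) = v , λ eq → F≢G (trans (proj₁ (proj₁ F-adm) u v)
                                              (trans (deleted≡⇒≡ F G v≢r eq) (proj₁ (proj₁ G-adm) v u)))

lemma1 : ∀ {n} (ρ : Rotation n) → IsHalinTree ρ →
    (r : Fin n) (d : ℕ) → IsDepth ρ r d →
    (i : ℕ) → 1 ≤ i →
    (S : Subset n) → ((l : Fin n) → l ∈ₛ S → IsLeaf ρ l) → ∣ S ∣ ≡ i →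
    (L : List (EdgeSet n)) → AllPairs Differ L →
    All (λ F → IsSpanningTreeOfH ρ F ×
               ((u v : Fin n) → AdjC ρ u v →
                  (F u v ≡ true) ⇔ ((u ∈ₛ S × nextLeaf ρ u ≡ v) ⊎ (v ∈ₛ S × nextLeaf ρ v ≡ u)))) L →
    length L ≤ (i !) * ((2 * d) ^ i)
lemma1 ρ (ρ-plane , _ , a , b , _ , _ , _ , _ , a≢b , _ , _) r d D i _ S S-leaves ∣S∣≡i L ≠L adm = begin
  length L                   ≡⟨ length-map deleted L ⟨
  length (map deleted L)     ≤⟨ distinct-subsets≤C covered (map deleted L) distinct subsets ⟩
  ∣ covered ∣ᵇ C (K / 2)     ≤⟨ C-bound 1≤2d (subst (K / 2 ≤_) ∣S∣≡i K/2≤∣S∣) ∣covered∣≤2d*i ⟩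
  i ! * (2 * d) ^ i          ∎
  where
  open ≤-Reasoning
  open RootedPlaneTree ρ ρ-plane r using (1≤depth-bound)
  open CycleEdgeSelection ρ ρ-plane r S S-leaves
  distinct = AllPairs.map⁺ (AllPairs-mapWith-All deleted-differs adm ≠L)
  subsets = All.map⁺ (All.map (λ F-adm → deleted⊆covered F-adm , ∣deleted∣ᵇ≡K/2 F-adm) adm)
  nonroot : ∃[ v ] v ≢ r
  nonroot with a ≟ r
  ... | yes refl = b , a≢b ∘ sym
  ... | no  a≢r  = a , a≢r
  1≤2d : 1 ≤ 2 * d
  1≤2d = ≤-trans (1≤depth-bound (proj₂ nonroot) D) (m≤m+n d _)
  ∣covered∣≤2d*i : ∣ covered ∣ᵇ ≤ 2 * d * i
  ∣covered∣≤2d*i =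
    subst (∣ covered ∣ᵇ ≤_) (trans (cong (_* (2 * d)) ∣S∣≡i) (*-comm i (2 * d))) (∣covered∣ᵇ≤ D)
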